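{- Let $T$ be a p-string over $\Sigma\cup\Pi$ whose last symbol is a sentinel $\$\in\Sigma$ occurring nowhere else in $T$, and let $(u,v)$ be an edge of $\mathsf{PLST}(T)$ such that both $u$ and $v$ are good. Then for every $i\in\{1,\dots,|\mathrm{str}(u,v)|\}\setminus\{\mathsf{Re}(v)\}$ we have $\mathrm{str}(u,v)[i]=\mathrm{str}(\mathsf{sl}(u),\mathsf{sl}(v))[i]$. Moreover, if $\mathsf{Re}(v)\ge1$, then $\mathrm{str}(u,v)[\mathsf{Re}(v)]=|u|+\mathsf{Re}(v)-1$ and $\mathrm{str}(\mathsf{sl}(u),\mathsf{sl}(v))[\mathsf{Re}(v)]=0$.
   Context: $\Sigma$ and $\Pi$ are disjoint alphabets of constant size; a p-string is a string over $\Sigma\cup\Pi$. For a string $w$: $|w|$ is its length, $w[i]$ its $i$-th symbol ($1$-indexed), $w[i:]$ its suffix starting at $i$. For strings $u$ and $uv$, $\mathrm{str}(u,uv)=v$. $\mathbb{N}$ denotes the non-negative integers. Prev-encoding: $\mathrm{pre}(w)$ has length $|w|$ with $\mathrm{pre}(w)[i]=w[i]$ if $w[i]\in\Sigma$; $=0$ if $w[i]\in\Pi$ does not occur among $w[1],\dots,w[i-1]$; $=i-k$ with $k=\max\{j<i:w[j]=w[i]\}$ otherwise. For a string $u$ over $\Sigma\cup\mathbb{N}$, $\langle u\rangle$ has length $|u|$ with $\langle u\rangle[i]=0$ if $u[i]\in\mathbb{N}$ and $u[i]\ge i$, else $u[i]$; for nonempty $u$, $\mathsf{sl}(u)=\langle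 u[2:]\rangle$. $\mathsf{PrevSub}(T)=\{\mathrm{pre}(w):w\text{ a substring of }T\}$; $\mathsf{PSTrie}(T)$ is the trie with node set $\mathsf{PrevSub}(T)$, root $\varepsilon$, edges $u\to ua$. Type 1 nodes: leaves and branching nodes (at least two children) of $\mathsf{PSTrie}(T)$, including the root; Type 2 nodes: $u$ not Type 1 with $\mathsf{sl}(u)$ Type 1. $\mathsf{PLST}(T)$ has node set $V$ = Type 1 $\cup$ Type 2 nodes and an edge $(u,uv)$ iff $v\ne\varepsilon$ and no proper nonempty prefix $v'$ of $v$ has $uv'\in V$. A node $u\in V$ is good if $u\ne\varepsilon$ and $\mathsf{sl}(u)\in V$. For a non-root node $v\in V$ with parent $u$, the re-encoding sign is $\mathsf{Re}(v)=i-|u|$ if there exists $i$ with $|u|<i\le|v|$ and $v[i]=i-1$ (such $i$ is unique), and $\mathsf{Re}(v)=0$ otherwise. -}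

module Defs where

open import Data.Nat using (ℕ; zero; suc; _+_; _∸_; _≤?_; _≡ᵇ_)
open import Data.Fin as Fin using (Fin)
open import Data.Sum using (_⊎_; inj₁; inj₂)
open import Data.Product using (Σ; ∃; _×_; _,_)
open import Data.List using (List; []; _∷_; _++_; length; drop; [_])
open import Data.Maybe using (Maybe; just; nothing; fromMaybe; maybe)
import Data.Maybe as Maybe
open import Data.Bool using (if_then_else_)
open import Relation.Nullary using (¬_; does; yes; no)
open import Relation.Binary.PropositionalEquality using (_≡_; _≢_)

-- Σ = Fin σ (static symbols), Π = Fin π (parameter symbols); disjoint via ⊎.
Sym : ℕ → ℕ → Set
Sym σ π = Fin σ ⊎ Fin π

PString : ℕ → ℕ → Set
PString σ π = List (Sym σ π)

Enc : ℕ → Set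
Enc σ = Fin σ ⊎ ℕ

-- 1-indexed lookup: xs ‼ i = just xs[i] if 1 ≤ i ≤ |xs|, nothing otherwise
_‼_ : {A : Set} → List A → ℕ → Maybe A
xs ‼ zero = nothing
[] ‼ suc _ = nothing
(x ∷ xs) ‼ suc zero = just x
(x ∷ xs) ‼ suc (suc n) = xs ‼ suc n

-- distance (≥ 1) back to the most recent occurrence of b in the reversed prefix
findPrev : {σ π : ℕ} → Fin π → List (Sym σ π) → Maybe ℕ
findPrev b [] = nothing
findPrev b (inj₁ _ ∷ xs) = Maybe.map suc (findPrev b xs)
findPrev b (inj₂ c ∷ xs) with b Fin.≟ c
... | yes _ = just 1
... | no _ = Maybe.map suc (findPrev b xs)

-- acc is the already-read prefix, reversed
pre-go : {σ π : ℕ} → List (Sym σ π) → List (Sym σ π) → List (Enc σ)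
pre-go acc [] = []
pre-go acc (inj₁ a ∷ xs) = inj₁ a ∷ pre-go (inj₁ a ∷ acc) xs
pre-go acc (inj₂ b ∷ xs) = inj₂ (fromMaybe 0 (findPrev b acc)) ∷ pre-go (inj₂ b ∷ acc) xs

pre : {σ π : ℕ} → PString σ π → List (Enc σ)
pre w = pre-go [] w

-- ⟨u⟩, with i the (1-based) position of the head
angle-go : {σ : ℕ} → ℕ → List (Enc σ) → List (Enc σ)
angle-go i [] = []
angle-go i (inj₁ a ∷ xs) = inj₁ a ∷ angle-go (suc i) xs
angle-go i (inj₂ n ∷ xs) = (if does (i ≤? n) then inj₂ 0 else inj₂ n) ∷ angle-go (suc i) xs

⟨_⟩ : {σ : ℕ} → List (Enc σ) → List (Enc σ)
⟨ u ⟩ = angle-go 1 u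

-- suffix link sl(u) = ⟨u[2:]⟩ (only used for nonempty u; sl ε := ε arbitrarily)
sl : {σ : ℕ} → List (Enc σ) → List (Enc σ)
sl [] = []
sl (_ ∷ xs) = ⟨ xs ⟩

str : {σ : ℕ} → List (Enc σ) → List (Enc σ) → List (Enc σ)
str u w = drop (length u) w

Substring : {A : Set} → List A → List A → Set
Substring {A} w T = Σ (List A) λ xs → Σ (List A) λ ys → T ≡ xs ++ w ++ ys

PrevSub : {σ π : ℕ} → PString σ π → List (Enc σ) → Set
PrevSub {σ} {π} T u = Σ (PString σ π) λ w → Substring w T × pre w ≡ u

-- nodes of PSTrie(T) are PrevSub(T); children of u are u ++ [a]
IsLeaf : {σ π : ℕ} → PString σ π → List (Enc σ) → Set
IsLeaf {σ} T u = ∀ (a : Enc σ) → ¬ PrevSub T (u ++ [ a ])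

IsBranching : {σ π : ℕ} → PString σ π → List (Enc σ) → Set
IsBranching {σ} T u = Σ (Enc σ) λ a → Σ (Enc σ) λ b →
  a ≢ b × PrevSub T (u ++ [ a ]) × PrevSub T (u ++ [ b ])

Type1 : {σ π : ℕ} → PString σ π → List (Enc σ) → Set
Type1 T u = PrevSub T u × (IsLeaf T u ⊎ IsBranching T u ⊎ u ≡ [])

Type2 : {σ π : ℕ} → PString σ π → List (Enc σ) → Set
Type2 T u = PrevSub T u × ¬ Type1 T u × u ≢ [] × Type1 T (sl u)

V : {σ π : ℕ} → PString σ π → List (Enc σ) → Set
V T u = Type1 T u ⊎ Type2 T u

Edge : {σ π : ℕ} → PString σ π → List (Enc σ) → List (Enc σ) → Set
Edge {σ} T u w = V T u × V T w × Σ (List (Enc σ)) λ v → w ≡ u ++ v × v ≢ [] ×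
  (∀ v' v'' → v ≡ v' ++ v'' → v' ≢ [] → v'' ≢ [] → ¬ V T (u ++ v'))

Good : {σ π : ℕ} → PString σ π → List (Enc σ) → Set
Good T u = u ≢ [] × V T (sl u)

re-go : {σ : ℕ} → ℕ → ℕ → List (Enc σ) → Maybe ℕ
re-go m k [] = nothing
re-go m k (inj₁ _ ∷ xs) = re-go m (suc k) xs
re-go m k (inj₂ n ∷ xs) = if n ≡ᵇ (m + k ∸ 1) then just k else re-go m (suc k) xs

Re : {σ : ℕ} → List (Enc σ) → List (Enc σ) → ℕ
Re u v = fromMaybe 0 (re-go (length u) 1 (drop (length u) v))

-- Write v = u y = pre w.  Then str(u,v) = y, and str(sl u, sl v) is y with the value at
-- each position reset to 0 exactly when it is at least the position's index in sl v.
-- A prev-encoding value is smaller than its position, so a reset happens only when the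
-- value points back to the very first symbol of w.  At most one position does so: after
-- such a link the first symbol is no longer the latest occurrence of that parameter.
-- Hence the unique reset position is the one Re finds, and the theorem only uses that
-- v is a prev-encoded substring and u is nonempty.

module Submission where

open import Defs
open import Data.Nat using (ℕ; zero; suc; _+_; _∸_; _≤_; z≤n; s≤s; _≤?_; _≡ᵇ_)
open import Data.Nat.Properties
  using (+-suc; +-identityʳ; +-cancelˡ-≡; ≤-trans; ≤-reflexive; ≤-antisym; ≡ᵇ⇒≡; ≡⇒≡ᵇ)
open import Data.Fin as Fin using (Fin)
open import Data.Sum using (inj₁; inj₂)
open import Data.Sum.Properties using (inj₂-injective)
open import Data.Product using (∃; _×_; _,_)
open import Data.List using (List; []; _∷_; _++_; [_]; length; drop)
open import Data.List.Membership.Propositional using (_∈_)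
open import Data.Maybe using (just; nothing; fromMaybe)
import Data.Maybe as Maybe
open import Data.Maybe.Properties using (just-injective)
open import Data.Bool using (true; false; T; if_then_else_)
open import Data.Unit using (tt)
open import Data.Empty using (⊥-elim)
open import Function using (_∘_)
open import Relation.Nullary using (¬_; yes; no; does)
open import Relation.Nullary.Decidable using (dec-true; dec-false)
open import Relation.Binary.PropositionalEquality
  using (_≡_; _≢_; refl; sym; trans; cong; subst)

‼-∷ : ∀ {A : Set} (x : A) xs d {z} → xs ‼ d ≡ just z → (x ∷ xs) ‼ suc d ≡ just z
‼-∷ x xs (suc d) e = e

‼-++ : ∀ {A : Set} (u y : List A) j → (u ++ y) ‼ suc (length u + j) ≡ y ‼ suc j
‼-++ []      y j = refl
‼-++ (a ∷ u) y j = ‼-++ u y j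

‼-just⇒≤length : ∀ {A : Set} (xs : List A) d {z} → xs ‼ d ≡ just z → d ≤ length xs
‼-just⇒≤length (x ∷ xs) (suc zero)    _ = s≤s z≤n
‼-just⇒≤length (x ∷ xs) (suc (suc d)) e = s≤s (‼-just⇒≤length xs (suc d) e)

drop-length-++ : ∀ {A : Set} (u y : List A) → drop (length u) (u ++ y) ≡ y
drop-length-++ []      y = refl
drop-length-++ (a ∷ u) y = drop-length-++ u y

findPrev-sound : ∀ {σ π} (b : Fin π) (acc : List (Sym σ π)) {d} →
  findPrev b acc ≡ just d → acc ‼ d ≡ just (inj₂ b)
findPrev-sound b (inj₁ _ ∷ acc) e with findPrev b acc in eq | e
... | just d | refl = ‼-∷ _ acc d (findPrev-sound b acc eq)
findPrev-sound b (inj₂ c ∷ acc) e with b Fin.≟ c | e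
... | yes refl | refl = refl
... | no _     | e′ with findPrev b acc in eq | e′
...   | just d | refl = ‼-∷ _ acc d (findPrev-sound b acc eq)

pre-go-‼-bound : ∀ {σ π} (acc xs : List (Sym σ π)) j {n} →
  pre-go acc xs ‼ suc j ≡ just (inj₂ n) → n ≤ length acc + j
pre-go-‼-bound acc (inj₁ a ∷ xs) (suc j) e =
  ≤-trans (pre-go-‼-bound (inj₁ a ∷ acc) xs j e) (≤-reflexive (sym (+-suc (length acc) j)))
pre-go-‼-bound acc (inj₂ b ∷ xs) (suc j) e =
  ≤-trans (pre-go-‼-bound (inj₂ b ∷ acc) xs j e) (≤-reflexive (sym (+-suc (length acc) j)))
pre-go-‼-bound acc (inj₂ b ∷ xs) zero refl with findPrev b acc in eq
... | nothing = z≤n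
... | just d =
  ≤-trans (‼-just⇒≤length acc d (findPrev-sound b acc eq)) (≤-reflexive (sym (+-identityʳ _)))

pre-‼-bound : ∀ {σ π} (w : PString σ π) p {n} → pre w ‼ suc p ≡ just (inj₂ n) → n ≤ p
pre-‼-bound w = pre-go-‼-bound [] w

-- Read with acc the reversed prefix: position j of xs points back to the first symbol.
LinksToFirst : ∀ {σ π} → List (Sym σ π) → List (Sym σ π) → ℕ → Set
LinksToFirst acc xs j = pre-go acc xs ‼ suc j ≡ just (inj₂ (length acc + j))

LatestNotFirst : ∀ {σ π} → List (Sym σ π) → Set
LatestNotFirst {π = π} acc = (b : Fin π) → findPrev b acc ≢ just (length acc)

linksToFirst-shift : ∀ {σ π} (acc : List (Sym σ π)) y xs j →
  LinksToFirst acc (y ∷ xs) (suc j) → LinksToFirst (y ∷ acc) xs j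
linksToFirst-shift acc (inj₁ _) xs j l = trans l (cong (just ∘ inj₂) (+-suc (length acc) j))
linksToFirst-shift acc (inj₂ _) xs j l = trans l (cong (just ∘ inj₂) (+-suc (length acc) j))

linksToFirst-head : ∀ {σ π} (a : Sym σ π) acc y xs → LinksToFirst (a ∷ acc) (y ∷ xs) 0 →
  ∃ λ c → y ≡ inj₂ c × findPrev c (a ∷ acc) ≡ just (length (a ∷ acc))
linksToFirst-head a acc (inj₂ c) xs l with findPrev c (a ∷ acc) in eq | l
... | just _ | refl = c , refl , trans eq (cong (just ∘ suc) (+-identityʳ (length acc)))

latestNotFirst-∷ : ∀ {σ π} (y a : Sym σ π) acc →
  LatestNotFirst (a ∷ acc) → LatestNotFirst (y ∷ a ∷ acc)
latestNotFirst-∷ (inj₁ _) a acc h b e with findPrev b (a ∷ acc) in eq | e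
... | just _ | refl = h b eq
latestNotFirst-∷ (inj₂ c) a acc h b e with b Fin.≟ c | e
... | no _ | e′ with findPrev b (a ∷ acc) in eq | e′
...   | just _ | refl = h b eq

latestNotFirst-after-link : ∀ {σ π} (c : Fin π) (acc : List (Sym σ π)) →
  findPrev c acc ≡ just (length acc) → LatestNotFirst (inj₂ c ∷ acc)
latestNotFirst-after-link c acc f b e with b Fin.≟ c | e
latestNotFirst-after-link c (_ ∷ _) f b e | yes _ | ()
... | no b≢c | e′ with findPrev b acc in eq | e′
...   | just _ | refl =
  b≢c (inj₂-injective (just-injective (trans (sym (findPrev-sound b acc eq)) (findPrev-sound c acc f))))

latestNotFirst⇒¬linksToFirst : ∀ {σ π} (a : Sym σ π) acc xs j →
  LatestNotFirst (a ∷ acc) → ¬ LinksToFirst (a ∷ acc) xs j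
latestNotFirst⇒¬linksToFirst a acc (y ∷ xs) zero h l with linksToFirst-head a acc y xs l
... | c , _ , f = h c f
latestNotFirst⇒¬linksToFirst a acc (y ∷ xs) (suc j) h l =
  latestNotFirst⇒¬linksToFirst y (a ∷ acc) xs j (latestNotFirst-∷ y a acc h)
    (linksToFirst-shift (a ∷ acc) y xs j l)

-- After a link to the first symbol, that link is the latest occurrence of the symbol.
¬linksToFirst-after : ∀ {σ π} (a : Sym σ π) acc y xs j →
  LinksToFirst (a ∷ acc) (y ∷ xs) 0 → ¬ LinksToFirst (a ∷ acc) (y ∷ xs) (suc j)
¬linksToFirst-after a acc y xs j l l′ with linksToFirst-head a acc y xs l
... | c , refl , f =
  latestNotFirst⇒¬linksToFirst y (a ∷ acc) xs j (latestNotFirst-after-link c (a ∷ acc) f)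
    (linksToFirst-shift (a ∷ acc) y xs j l′)

linksToFirst-unique : ∀ {σ π} (a : Sym σ π) acc xs {j j′} →
  LinksToFirst (a ∷ acc) xs j → LinksToFirst (a ∷ acc) xs j′ → j ≡ j′
linksToFirst-unique a acc (y ∷ xs) {zero}  {zero}   l l′ = refl
linksToFirst-unique a acc (y ∷ xs) {zero}  {suc j′} l l′ =
  ⊥-elim (¬linksToFirst-after a acc y xs j′ l l′)
linksToFirst-unique a acc (y ∷ xs) {suc j} {zero}   l l′ =
  ⊥-elim (¬linksToFirst-after a acc y xs j l′ l)
linksToFirst-unique a acc (y ∷ xs) {suc j} {suc j′} l l′ =
  cong suc (linksToFirst-unique y (a ∷ acc) xs (linksToFirst-shift (a ∷ acc) y xs j l)
                                               (linksToFirst-shift (a ∷ acc) y xs j′ l′))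

PointsToFirst : ∀ {σ} → List (Enc σ) → ℕ → Set
PointsToFirst v p = v ‼ suc p ≡ just (inj₂ p)

pre-pointsToFirst-unique : ∀ {σ π} (w : PString σ π) {p p′} →
  PointsToFirst (pre w) (suc p) → PointsToFirst (pre w) (suc p′) → p ≡ p′
pre-pointsToFirst-unique (y@(inj₁ _) ∷ w) = linksToFirst-unique y [] w
pre-pointsToFirst-unique (y@(inj₂ _) ∷ w) = linksToFirst-unique y [] w

mask : ∀ {σ} → ℕ → Enc σ → Enc σ
mask i (inj₁ a) = inj₁ a
mask i (inj₂ n) = if does (i ≤? n) then inj₂ 0 else inj₂ n

mask-< : ∀ {σ} {i n} → ¬ i ≤ n → mask {σ} i (inj₂ n) ≡ inj₂ n
mask-< {i = i} {n} i≰n rewrite dec-false (i ≤? n) i≰n = refl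

mask-self : ∀ {σ} i → mask {σ} i (inj₂ i) ≡ inj₂ 0
mask-self i rewrite dec-true (i ≤? i) (≤-reflexive refl) = refl

angle-go-‼ : ∀ {σ} i (x : List (Enc σ)) j →
  angle-go i x ‼ suc j ≡ Maybe.map (mask (i + j)) (x ‼ suc j)
angle-go-‼ i []            j       = refl
angle-go-‼ i (inj₁ a ∷ xs) zero    = refl
angle-go-‼ i (inj₂ n ∷ xs) zero    rewrite +-identityʳ i = refl
angle-go-‼ i (inj₁ a ∷ xs) (suc j) rewrite +-suc i j = angle-go-‼ (suc i) xs j
angle-go-‼ i (inj₂ n ∷ xs) (suc j) rewrite +-suc i j = angle-go-‼ (suc i) xs j

length-angle-go : ∀ {σ} i (u : List (Enc σ)) → length (angle-go i u) ≡ length u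
length-angle-go i []            = refl
length-angle-go i (inj₁ _ ∷ u) = cong suc (length-angle-go (suc i) u)
length-angle-go i (inj₂ _ ∷ u) = cong suc (length-angle-go (suc i) u)

drop-angle-go : ∀ {σ} i (u y : List (Enc σ)) →
  drop (length u) (angle-go i (u ++ y)) ≡ angle-go (i + length u) y
drop-angle-go i []           y rewrite +-identityʳ i = refl
drop-angle-go i (inj₁ _ ∷ u) y rewrite +-suc i (length u) = drop-angle-go (suc i) u y
drop-angle-go i (inj₂ _ ∷ u) y rewrite +-suc i (length u) = drop-angle-go (suc i) u y

str-sl-++ : ∀ {σ} (u y : List (Enc σ)) → u ≢ [] →
  str (sl u) (sl (u ++ y)) ≡ angle-go (length u) y
str-sl-++ []      y u≢[] = ⊥-elim (u≢[] refl)
str-sl-++ (a ∷ u) y _ rewrite length-angle-go 1 u = drop-angle-go 1 u y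

-- Re u v unfolds to firstHit (length u) (str u v).
firstHit : ∀ {σ} → ℕ → List (Enc σ) → ℕ
firstHit m y = fromMaybe 0 (re-go m 1 y)

-- Position j of y (following a prefix of length m) points back to the first symbol.
Hit : ∀ {σ} → ℕ → List (Enc σ) → ℕ → Set
Hit m y j = y ‼ suc j ≡ just (inj₂ (m + j))

hit-+0 : ∀ {σ} m (y : List (Enc σ)) j → Hit (m + 0) y j → Hit m y j
hit-+0 m y j = subst (λ b → Hit b y j) (+-identityʳ m)

+-suc-swap : ∀ m k j → m + suc k + j ≡ m + k + suc j
+-suc-swap m k j = trans (cong (_+ j) (+-suc m k)) (sym (+-suc (m + k) j))

hit-∷ : ∀ {σ} m k (z : Enc σ) xs j → Hit (m + suc k) xs j → Hit (m + k) (z ∷ xs) (suc j)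
hit-∷ m k z xs j h = trans h (cong (just ∘ inj₂) (+-suc-swap m k j))

hit-∷⁻ : ∀ {σ} m k (z : Enc σ) xs j → Hit (m + k) (z ∷ xs) (suc j) → Hit (m + suc k) xs j
hit-∷⁻ m k z xs j h = trans h (cong (just ∘ inj₂) (sym (+-suc-swap m k j)))

+-suc-∸1 : ∀ m k → m + suc k ∸ 1 ≡ m + k
+-suc-∸1 m k = cong (_∸ 1) (+-suc m k)

re-go-sound : ∀ {σ} m k (x : List (Enc σ)) {r} → re-go m (suc k) x ≡ just r →
  ∃ λ j → r ≡ suc (k + j) × Hit (m + k) x j
re-go-sound m k (inj₁ a ∷ x) e with re-go-sound m (suc k) x e
... | j , refl , h = suc j , cong suc (sym (+-suc k j)) , hit-∷ m k (inj₁ a) x j h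
re-go-sound m k (inj₂ n ∷ x) e with n ≡ᵇ (m + suc k ∸ 1) in b
re-go-sound m k (inj₂ n ∷ x) refl | true =
  0 , cong suc (sym (+-identityʳ k)) ,
  cong (just ∘ inj₂) (trans (≡ᵇ⇒≡ n _ (subst T (sym b) tt))
                            (trans (+-suc-∸1 m k) (sym (+-identityʳ (m + k)))))
re-go-sound m k (inj₂ n ∷ x) e | false with re-go-sound m (suc k) x e
... | j , refl , h = suc j , cong suc (sym (+-suc k j)) , hit-∷ m k (inj₂ n) x j h

re-go-complete : ∀ {σ} m k (x : List (Enc σ)) {j} → Hit (m + k) x j →
  ∃ λ r → re-go m (suc k) x ≡ just r
re-go-complete m k (inj₁ a ∷ x) {suc j} h = re-go-complete m (suc k) x (hit-∷⁻ m k (inj₁ a) x j h)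
re-go-complete m k (inj₂ n ∷ x) {j} h with n ≡ᵇ (m + suc k ∸ 1) in b
... | true = suc k , refl
re-go-complete m k (inj₂ n ∷ x) {zero} h | false =
  ⊥-elim (subst T b (≡⇒≡ᵇ n _ (trans (inj₂-injective (just-injective h))
                                     (trans (+-identityʳ (m + k)) (sym (+-suc-∸1 m k))))))
re-go-complete m k (inj₂ n ∷ x) {suc j} h | false =
  re-go-complete m (suc k) x (hit-∷⁻ m k (inj₂ n) x j h)

Bounded : ∀ {σ} → ℕ → List (Enc σ) → Set
Bounded m y = ∀ j {n} → y ‼ suc j ≡ just (inj₂ n) → n ≤ m + j

HitsUnique : ∀ {σ} → ℕ → List (Enc σ) → Set
HitsUnique m y = ∀ {j j′} → Hit m y j → Hit m y j′ → j ≡ j′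

firstHit-sound : ∀ {σ} m (y : List (Enc σ)) → 1 ≤ firstHit m y →
  ∃ λ j → firstHit m y ≡ suc j × Hit m y j
firstHit-sound m y 1≤ with re-go m 1 y in e
... | just r with re-go-sound m 0 y e
...   | j , refl , h = j , refl , hit-+0 m y j h

hit⇒firstHit : ∀ {σ} m (y : List (Enc σ)) → HitsUnique m y →
  ∀ j → Hit m y j → firstHit m y ≡ suc j
hit⇒firstHit m y unique j h
  with re-go-complete m 0 y (subst (λ b → Hit b y j) (sym (+-identityʳ m)) h)
... | r , e with re-go-sound m 0 y e
...   | j′ , refl , h′ = trans (cong (fromMaybe 0) e) (cong suc (unique (hit-+0 m y j′ h′) h))

unmasked-off-hit : ∀ {σ} m (y : List (Enc σ)) → Bounded m y →
  ∀ j → ¬ Hit m y j → y ‼ suc j ≡ angle-go m y ‼ suc j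
unmasked-off-hit m y bounded j ¬hit rewrite angle-go-‼ m y j with y ‼ suc j in e
... | nothing = refl
... | just (inj₁ a) = refl
... | just (inj₂ n) with m + j ≤? n
...   | no m+j≰n = cong just (sym (mask-< m+j≰n))
...   | yes m+j≤n = ⊥-elim (¬hit (cong (just ∘ inj₂) (≤-antisym (bounded j e) m+j≤n)))

masked-at-hit : ∀ {σ} m (y : List (Enc σ)) j → Hit m y j →
  angle-go m y ‼ suc j ≡ just (inj₂ 0)
masked-at-hit m y j h =
  trans (angle-go-‼ m y j) (trans (cong (Maybe.map (mask (m + j))) h) (cong just (mask-self (m + j))))

reencoding-agrees : ∀ {σ} m (y : List (Enc σ)) → Bounded m y → HitsUnique m y →
  (i : ℕ) → 1 ≤ i → i ≤ length y → i ≢ firstHit m y → y ‼ i ≡ angle-go m y ‼ i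
reencoding-agrees m y bounded unique (suc j) _ _ i≢first =
  unmasked-off-hit m y bounded j (λ h → i≢first (sym (hit⇒firstHit m y unique j h)))

reencoding-marks : ∀ {σ} m (y : List (Enc σ)) → 1 ≤ firstHit m y →
  (y ‼ firstHit m y ≡ just (inj₂ (m + firstHit m y ∸ 1)))
  × (angle-go m y ‼ firstHit m y ≡ just (inj₂ 0))
reencoding-marks m y 1≤first with firstHit-sound m y 1≤first
... | j , first≡ , h rewrite first≡ =
  trans h (cong (just ∘ inj₂) (sym (+-suc-∸1 m j))) , masked-at-hit m y j h

pre-bounded : ∀ {σ π} (w : PString σ π) (u y : List (Enc σ)) → pre w ≡ u ++ y →
  Bounded (length u) y
pre-bounded w u y pre-w j e =
  pre-‼-bound w (length u + j) (trans (cong (_‼ suc (length u + j)) pre-w) (trans (‼-++ u y j) e))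

pre-hitsUnique : ∀ {σ π} (w : PString σ π) (u y : List (Enc σ)) → u ≢ [] → pre w ≡ u ++ y →
  HitsUnique (length u) y
pre-hitsUnique w []      y u≢[] _ = ⊥-elim (u≢[] refl)
pre-hitsUnique w (a ∷ u) y _ pre-w h h′ =
  +-cancelˡ-≡ (length u) _ _ (pre-pointsToFirst-unique w (pointsToFirst h) (pointsToFirst h′))
  where
  pointsToFirst : ∀ {j} → Hit (length (a ∷ u)) y j → PointsToFirst (pre w) (suc (length u + j))
  pointsToFirst {j} h =
    trans (cong (_‼ suc (length (a ∷ u) + j)) pre-w) (trans (‼-++ (a ∷ u) y j) h)

V⇒PrevSub : ∀ {σ π} {T : PString σ π} {u} → V T u → PrevSub T u
V⇒PrevSub (inj₁ (ps , _)) = ps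
V⇒PrevSub (inj₂ (ps , _)) = ps

lemma1 : {σ π : ℕ} (T T' : PString σ π) (d : Fin σ) →
    T ≡ T' ++ [ inj₁ d ] → ¬ (inj₁ d ∈ T') →
    (u v : List (Enc σ)) → Edge T u v → Good T u → Good T v →
    ((i : ℕ) → 1 ≤ i → i ≤ length (str u v) → i ≢ Re u v →
       str u v ‼ i ≡ str (sl u) (sl v) ‼ i)
    × (1 ≤ Re u v →
       (str u v ‼ Re u v ≡ just (inj₂ (length u + Re u v ∸ 1)))
       × (str (sl u) (sl v) ‼ Re u v ≡ just (inj₂ 0)))
lemma1 _ _ _ _ _ u _ (_ , Vv , y , refl , _) (u≢[] , _) _ with V⇒PrevSub Vv
... | w , _ , pre-w rewrite drop-length-++ u y | str-sl-++ u y u≢[] =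
  reencoding-agrees (length u) y (pre-bounded w u y pre-w) (pre-hitsUnique w u y u≢[] pre-w)
  , reencoding-marks (length u) y
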